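{- Let $g$ and $h$ be normalized arithmetic functions with $h$ non-vanishing, and let $1 \le m < n$ be integers. Then $$A_{n,m}^{g,h} = \sum_{\mu \vdash n-m} \mathcal{G}(\mu)\, \mathcal{H}(\mu,n),$$ where the sum runs over all partitions $\mu$ of $n-m$.
   Context: An arithmetic function is a map $f:\mathbb{N}=\{1,2,\dots\}\to\mathbb{C}$; it is normalized if $f(1)=1$. Let $g,h$ be normalized arithmetic functions with $h(n)\neq 0$ for all $n\ge1$, and put $h(0):=0$. Define polynomials by $P_0^{g,h}(x):=1$ and, for $n\ge1$, $P_n^{g,h}(x):=\frac{x}{h(n)}\sum_{k=1}^{n} g(k)\,P_{n-k}^{g,h}(x)$. Let $H(n):=\prod_{k=1}^n h(k)$, $H(0):=1$. Write $H(n)\,P_n^{g,h}(x)=\sum_{m=0}^{n} A_{n,m}^{g,h}x^m$ (so $A_{n,0}^{g,h}=0$ for $n\ge1$). For integers $m\ge 0$ and $n$ put $h_m(n):=\prod_{k=0}^{m-1}h(n-k)$. A composition $\mu=(\mu_1,\dots,\mu_r)$ is a finite sequence of positive integers, with length $\ell(\mu)=r$ and size $|\mu|=\sum_i\mu_i$; the empty composition $\varepsilon$ has $\ell(\varepsilon)=|\varepsilon|=0$. A partition is a composition with $\mu_1\ge\dots\ge\mu_r$; $\mu\vdash N$ means $\mu$ is a partition of size $N$. The symmetric group $S_r$ acts on compositions of length $r$ by permuting parts; $\mathrm{Orb}(\mu)$ denotes the set of distinct compositions obtained by permuting the parts of $\mu$. For a partition $\mu$, $\mathcal{G}(\mu):=\prod_{k=1}^{\ell(\mu)}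 g(\mu_k+1)$. Define $H(\mu,n)$ for compositions $\mu$ (including $\varepsilon$) and integers $n\ge0$ by induction on length: $H(\varepsilon,n):=1$; if $\mu=(\mu_1,\dots,\mu_{r+1})$ has length $r+1\ge1$, then for $n\ge|\mu|+\ell(\mu)$, $$H(\mu,n):=\sum_{k=|\mu|+\ell(\mu)-1}^{n-1} h_{\mu_{r+1}}(k)\,H\big((\mu_1,\dots,\mu_r),\,k-\mu_{r+1}\big),$$ and $H(\mu,n):=0$ if $n<|\mu|+\ell(\mu)$. Finally $\mathcal{H}(\mu,n):=\sum_{\lambda\in\mathrm{Orb}(\mu)}H(\lambda,n)$. -}

module Defs where

open import Level using (Level)
open import Algebra.Bundles using (CommutativeRing)
open import Data.Nat as ℕ using (ℕ; zero; suc; _∸_; _<ᵇ_)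
open import Data.Bool using (Bool; true; false; if_then_else_; _∧_)
open import Data.List as List using (List; []; _∷_; map; concatMap; upTo; filterᵇ; length; reverse)
open import Data.Nat.ListAction using (sum)
open import Data.List.Properties using (≡-dec)
open import Data.Vec as Vec using (Vec; _∷_; [])
open import Relation.Nullary using (does)

-- compositions (ordered, positive parts) of N; the first argument is fuel
compsF : ℕ → ℕ → List (List ℕ)
compsF _ zero = [] ∷ []
compsF zero (suc n) = []
compsF (suc f) (suc n) =
  concatMap (λ k → map (suc k ∷_) (compsF f (n ∸ k))) (upTo (suc n))

compositions : ℕ → List (List ℕ)
compositions N = compsF N N

size : List ℕ → ℕ
size = sum

nonincreasing : List ℕ → Bool
nonincreasing [] = true
nonincreasing (a ∷ []) = true
nonincreasing (a ∷ b ∷ xs) = (b ℕ.≤ᵇ a) ∧ nonincreasing (b ∷ xs)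

partitions : ℕ → List (List ℕ)
partitions N = filterᵇ nonincreasing (compositions N)

insertDesc : ℕ → List ℕ → List ℕ
insertDesc a [] = a ∷ []
insertDesc a (b ∷ xs) = if b ℕ.≤ᵇ a then a ∷ b ∷ xs else b ∷ insertDesc a xs

sortDesc : List ℕ → List ℕ
sortDesc [] = []
sortDesc (a ∷ xs) = insertDesc a (sortDesc xs)

isPermOf : List ℕ → List ℕ → Bool
isPermOf lam mu = does (≡-dec ℕ._≟_ (sortDesc lam) (sortDesc mu))

Orb : List ℕ → List (List ℕ)
Orb mu = filterᵇ (λ lam → isPermOf lam mu) (compositions (size mu))

-- Ring-valued objects.  Arithmetic functions are modelled as ℕ → Carrier
-- (value at 0 is ignored; h(0) := 0 is imposed via hext).

module Gen {c ℓ : Level} (R : CommutativeRing c ℓ) where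
  open CommutativeRing R

  Σl : List Carrier → Carrier
  Σl = List.foldr _+_ 0#

  Πl : List Carrier → Carrier
  Πl = List.foldr _*_ 1#

  -- Σ_{k=a}^{b} f k  (empty if b < a)
  sumRange : ℕ → ℕ → (ℕ → Carrier) → Carrier
  sumRange a b f = Σl (map (λ i → f (a ℕ.+ i)) (upTo (suc b ∸ a)))

  module Arith (g h : ℕ → Carrier) where

    hext : ℕ → Carrier
    hext zero = 0#
    hext (suc n) = h (suc n)

    Hprod : ℕ → Carrier
    Hprod zero = 1#
    Hprod (suc n) = Hprod n * h (suc n)

    -- h_m(n) = ∏_{k=0}^{m-1} h(n-k)   (n ≥ 0 here; arguments n-k are only used when ≥ 0)
    hm : ℕ → ℕ → Carrier
    hm m n = Πl (map (λ k → hext (n ∸ k)) (upTo m))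

    𝒢 : List ℕ → Carrier
    𝒢 mu = Πl (map (λ a → g (suc a)) mu)

    -- H(μ, n), defined on the reversed composition (last part first)
    Hrev : List ℕ → ℕ → Carrier
    Hrev [] n = 1#
    Hrev (a ∷ rest) n =
      let b = size (a ∷ rest) ℕ.+ length (a ∷ rest) in
      if n <ᵇ b then 0#
      else sumRange (b ∸ 1) (n ∸ 1) (λ k → hm a k * Hrev rest (k ∸ a))

    Hμ : List ℕ → ℕ → Carrier
    Hμ mu n = Hrev (reverse mu) n

    ℋ : List ℕ → ℕ → Carrier
    ℋ mu n = Σl (map (λ lam → Hμ lam n) (Orb mu))

    module Poly (hinv : ℕ → Carrier) where
      -- polynomials as coefficient functions ℕ → Carrier (coefficient of x^m)
      -- Ps n = [P_n, P_{n-1}, …, P_0]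
      wsum : ℕ → List (ℕ → Carrier) → ℕ → Carrier
      wsum k [] m = 0#
      wsum k (p ∷ ps) m = g k * p m + wsum (suc k) ps m

      Ps : (n : ℕ) → Vec (ℕ → Carrier) (suc n)
      Ps zero = (λ { zero → 1# ; (suc _) → 0# }) ∷ []
      Ps (suc n) = new ∷ Ps n
        where
        -- P_{n+1}(x) = x / h(n+1) · Σ_{k=1}^{n+1} g(k) P_{n+1-k}(x)
        new : ℕ → Carrier
        new zero = 0#
        new (suc m) = hinv (suc n) * wsum 1 (Vec.toList (Ps n)) m

      P : ℕ → ℕ → Carrier
      P n m = Vec.head (Ps n) m

      A : ℕ → ℕ → Carrier
      A n m = Hprod n * P n m

{-# OPTIONS --safe #-}
-- Multiplying the recursion for P_n by H(n) clears the denominators and gives the recurrence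
-- A(n+1, m+1) = Σ_{j ≤ n} g(j+1) h_j(n) A(n−j, m), which also forces A(n, m) = 0 for n < m.
-- Unrolling it, A(n, m) is the sum of 𝒢(r) H(r̄, n) over the compositions r of n − m, r̄ being r
-- reversed (the recurrence splits off the first part, the recursion of H the last one); the induction
-- step is the telescoping identity H(μ, n+1) = H(μ, n) + h_a(n) H(μ′, n − a) for μ = μ′a.
-- Reversal permutes the compositions of n − m, and 𝒢 is constant on each orbit Orb(μ),
-- so grouping the compositions by their sorted rearrangement yields the sum over partitions.
module Submission where

open import Defs
open import Level using (Level)
open import Algebra.Bundles using (CommutativeRing; CommutativeSemiring)
open import Data.Nat using (ℕ; _≤_; _<_; _∸_)
open import Data.List using (map)
open import Data.Nat as ℕ using (zero; suc; z≤n; s≤s)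
import Data.Nat.Properties as ℕP
open import Data.Bool using (Bool; true; false; if_then_else_; _∧_; T)
open import Data.List as List
  using (List; []; _∷_; _++_; foldr; length; reverse; concatMap; upTo; applyUpTo; filterᵇ)
import Data.List.Properties as ListP
import Data.Vec as Vec
open import Data.List.Relation.Unary.All as All using (All; []; _∷_)
import Data.List.Relation.Unary.All.Properties as AllP
open import Data.List.Relation.Binary.Permutation.Propositional
  using (_↭_; ↭-refl; ↭-sym; ↭-prep; ↭-swap; ↭-trans; ↭⇒↭ₛ′)
open import Data.List.Relation.Binary.Permutation.Setoid.Properties using (foldr-commMonoid)
import Data.List.Relation.Binary.Permutation.Propositional.Properties as ↭P
open import Data.Nat.ListAction.Properties using (sum-↭)
open import Data.Bool.Properties using (T-∧; if-swap-then)
open import Data.Product using (_×_; _,_; proj₁; proj₂)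
open import Function.Bundles using (Equivalence)
open import Relation.Nullary.Reflects using (Reflects; ofʸ; ofⁿ)
open import Function using (_∘_; id)
open import Relation.Binary.PropositionalEquality as ≡ using (_≡_; cong)
open import Relation.Nullary using (does; yes; no; contradiction)
open import Relation.Binary.Definitions using (DecidableEquality)

module ListSum {c ℓ : Level} (S : CommutativeSemiring c ℓ) where
  open CommutativeSemiring S
  open import Relation.Binary.Reasoning.Setoid setoid
  open import Algebra.Properties.CommutativeSemigroup +-commutativeSemigroup using (interchange)

  infix 6.5 ∑ ∑<

  ∑ : {A : Set} → List A → (A → Carrier) → Carrier
  ∑ xs f = foldr _+_ 0# (map f xs)

  syntax ∑ xs (λ x → e) = ∑[ x ∈ xs ] e

  ∑< : ℕ → (ℕ → Carrier) → Carrier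
  ∑< n f = foldr _+_ 0# (applyUpTo f n)

  syntax ∑< n (λ i → e) = ∑[ i < n ] e

  private variable A B : Set

  ∑-cong : ∀ (xs : List A) {f f′ : A → Carrier} → (∀ x → f x ≈ f′ x) → ∑ xs f ≈ ∑ xs f′
  ∑-cong []       eq = refl
  ∑-cong (x ∷ xs) eq = +-cong (eq x) (∑-cong xs eq)

  ∑-cong-All : ∀ {xs : List A} {f f′ : A → Carrier} →
               All (λ x → f x ≈ f′ x) xs → ∑ xs f ≈ ∑ xs f′
  ∑-cong-All []         = refl
  ∑-cong-All (eq ∷ eqs) = +-cong eq (∑-cong-All eqs)

  ∑-zero : ∀ (xs : List A) → ∑[ x ∈ xs ] 0# ≈ 0#
  ∑-zero []       = refl
  ∑-zero (x ∷ xs) = trans (+-identityˡ _) (∑-zero xs)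

  ∑-++ : (xs ys : List A) (f : A → Carrier) → ∑ (xs ++ ys) f ≈ ∑ xs f + ∑ ys f
  ∑-++ []       ys f = sym (+-identityˡ _)
  ∑-++ (x ∷ xs) ys f = trans (+-congˡ (∑-++ xs ys f)) (sym (+-assoc _ _ _))

  ∑-distrib-+ : ∀ (xs : List A) (f f′ : A → Carrier) →
                ∑[ x ∈ xs ] (f x + f′ x) ≈ ∑ xs f + ∑ xs f′
  ∑-distrib-+ []       f f′ = sym (+-identityˡ _)
  ∑-distrib-+ (x ∷ xs) f f′ = trans (+-congˡ (∑-distrib-+ xs f f′)) (interchange _ _ _ _)

  *-distribˡ-∑ : ∀ a (xs : List A) (f : A → Carrier) → a * ∑ xs f ≈ ∑[ x ∈ xs ] (a * f x)
  *-distribˡ-∑ a []       f = zeroʳ a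
  *-distribˡ-∑ a (x ∷ xs) f = trans (distribˡ _ _ _) (+-congˡ (*-distribˡ-∑ a xs f))

  ∑-filter : ∀ (p : A → Bool) (xs : List A) (f : A → Carrier) →
             ∑ (filterᵇ p xs) f ≈ ∑[ x ∈ xs ] (if p x then f x else 0#)
  ∑-filter p []       f = refl
  ∑-filter p (x ∷ xs) f with p x
  ... | true  = +-congˡ (∑-filter p xs f)
  ... | false = trans (∑-filter p xs f) (sym (+-identityˡ _))

  ∑-comm : (xs : List A) (ys : List B) (F : A → B → Carrier) →
           ∑[ x ∈ xs ] ∑[ y ∈ ys ] F x y ≈ ∑[ y ∈ ys ] ∑[ x ∈ xs ] F x y
  ∑-comm []       ys F = sym (∑-zero ys)
  ∑-comm (x ∷ xs) ys F = begin
    ∑ ys (F x) + ∑[ x′ ∈ xs ] ∑ ys (F x′)    ≈⟨ +-congˡ (∑-comm xs ys F) ⟩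
    ∑ ys (F x) + ∑[ y ∈ ys ] ∑[ x′ ∈ xs ] F x′ y ≈⟨ ∑-distrib-+ ys (F x) _ ⟨
    ∑[ y ∈ ys ] (F x y + ∑[ x′ ∈ xs ] F x′ y) ∎

  ∑-map : (g : B → A) (xs : List B) (f : A → Carrier) → ∑ (map g xs) f ≡ ∑ xs (f ∘ g)
  ∑-map g xs f = cong (foldr _+_ 0#) (≡.sym (ListP.map-∘ xs))

  ∑-concatMap : (G : B → List A) (xs : List B) (f : A → Carrier) →
                ∑ (concatMap G xs) f ≈ ∑[ x ∈ xs ] ∑ (G x) f
  ∑-concatMap G []       f = refl
  ∑-concatMap G (x ∷ xs) f = trans (∑-++ (G x) (concatMap G xs) f) (+-congˡ (∑-concatMap G xs f))

  ∑-upTo : ∀ n (f : ℕ → Carrier) → ∑ (upTo n) f ≡ ∑< n f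
  ∑-upTo n f = cong (foldr _+_ 0#) (ListP.map-upTo f n)

  ∑<-cong : ∀ n {f f′ : ℕ → Carrier} → (∀ i → i < n → f i ≈ f′ i) → ∑< n f ≈ ∑< n f′
  ∑<-cong zero    eq = refl
  ∑<-cong (suc n) eq = +-cong (eq 0 (s≤s z≤n)) (∑<-cong n (λ i i<n → eq (suc i) (s≤s i<n)))

  ∑<-vanishes : ∀ n {f : ℕ → Carrier} → (∀ i → i < n → f i ≈ 0#) → ∑< n f ≈ 0#
  ∑<-vanishes zero    eq = refl
  ∑<-vanishes (suc n) eq =
    trans (+-cong (eq 0 (s≤s z≤n)) (∑<-vanishes n (λ i i<n → eq (suc i) (s≤s i<n)))) (+-identityˡ _)

  ∑<-suc : ∀ n (f : ℕ → Carrier) → ∑< (suc n) f ≈ ∑< n f + f n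
  ∑<-suc zero    f = +-comm _ _
  ∑<-suc (suc n) f = trans (+-congˡ (∑<-suc n (f ∘ suc))) (sym (+-assoc _ _ _))

  ∑<-+ : ∀ m n (f : ℕ → Carrier) → ∑< (m ℕ.+ n) f ≈ ∑< m f + ∑[ i < n ] f (m ℕ.+ i)
  ∑<-+ zero    n f = sym (+-identityˡ _)
  ∑<-+ (suc m) n f = trans (+-congˡ (∑<-+ m n (f ∘ suc))) (sym (+-assoc _ _ _))

  *-distribˡ-∑< : ∀ a n (f : ℕ → Carrier) → a * ∑< n f ≈ ∑[ i < n ] (a * f i)
  *-distribˡ-∑< a zero    f = zeroʳ a
  *-distribˡ-∑< a (suc n) f = trans (distribˡ _ _ _) (+-congˡ (*-distribˡ-∑< a n (f ∘ suc)))

  ∑<-truncate : ∀ {t n} (f : ℕ → Carrier) → t ≤ n → (∀ i → t ≤ i → i < n → f i ≈ 0#) →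
                ∑< n f ≈ ∑< t f
  ∑<-truncate {t} {n} f t≤n eq = begin
    ∑< n f                                   ≡⟨ cong (λ k → ∑< k f) (≡.sym (ℕP.m+[n∸m]≡n t≤n)) ⟩
    ∑< (t ℕ.+ (n ∸ t)) f                     ≈⟨ ∑<-+ t (n ∸ t) f ⟩
    ∑< t f + ∑[ i < n ∸ t ] f (t ℕ.+ i)      ≈⟨ +-congˡ (∑<-vanishes (n ∸ t) tail) ⟩
    ∑< t f + 0#                               ≈⟨ +-identityʳ _ ⟩
    ∑< t f                                   ∎
    where
    tail : ∀ i → i < n ∸ t → f (t ℕ.+ i) ≈ 0#
    tail i i<n∸t = eq (t ℕ.+ i) (ℕP.m≤m+n t i)
      (≡.subst (t ℕ.+ i <_) (ℕP.m+[n∸m]≡n t≤n) (ℕP.+-monoʳ-< t i<n∸t))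

  ∑<-drop : ∀ {t n} (f : ℕ → Carrier) → t ≤ n → (∀ i → i < t → f i ≈ 0#) →
            ∑< n f ≈ ∑[ i < n ∸ t ] f (t ℕ.+ i)
  ∑<-drop {t} {n} f t≤n eq = begin
    ∑< n f                                   ≡⟨ cong (λ k → ∑< k f) (≡.sym (ℕP.m+[n∸m]≡n t≤n)) ⟩
    ∑< (t ℕ.+ (n ∸ t)) f                     ≈⟨ ∑<-+ t (n ∸ t) f ⟩
    ∑< t f + ∑[ i < n ∸ t ] f (t ℕ.+ i)      ≈⟨ +-congʳ (∑<-vanishes t eq) ⟩
    0# + ∑[ i < n ∸ t ] f (t ℕ.+ i)          ≈⟨ +-identityˡ _ ⟩
    ∑[ i < n ∸ t ] f (t ℕ.+ i)               ∎

  ∑<-δ : ∀ {b n} (f : ℕ → Carrier) → b < n → ∑[ k < n ] (if does (b ℕ.≟ k) then f k else 0#) ≈ f b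
  ∑<-δ {zero}  {suc n} f _          = trans (+-congˡ (∑<-vanishes n (λ _ _ → refl))) (+-identityʳ _)
  ∑<-δ {suc b} {suc n} f (s≤s b<n) = trans (+-identityˡ _) (∑<-δ (f ∘ suc) b<n)

∸-comm : ∀ m n o → m ∸ n ∸ o ≡ m ∸ o ∸ n
∸-comm m n o =
  ≡.trans (ℕP.∸-+-assoc m n o) (≡.trans (cong (m ∸_) (ℕP.+-comm n o)) (≡.sym (ℕP.∸-+-assoc m o n)))

∸-suc-< : ∀ {m n j} → n ∸ m ≤ j → j < n → n ∸ suc j < m
∸-suc-< {zero}  n≤j j<n = contradiction n≤j (ℕP.<⇒≱ j<n)
∸-suc-< {suc m} {n} {j} n∸m≤j _ = ℕP.m<n+o⇒m∸n<o n (suc j) (s≤s n≤j+m)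
  where
  n≤j+m : n ≤ j ℕ.+ suc m
  n≤j+m = ℕP.≤-trans (ℕP.m≤n+m∸n n (suc m))
            (ℕP.≤-trans (ℕP.+-monoʳ-≤ (suc m) n∸m≤j) (ℕP.≤-reflexive (ℕP.+-comm (suc m) j)))

if-T : ∀ {a} {A : Set a} {b} {x y : A} → T b → (if b then x else y) ≡ x
if-T {b = true} _ = ≡.refl

infix 4 _⊨_ _≟ₗ_

_≟ₗ_ : DecidableEquality (List ℕ)
_≟ₗ_ = ListP.≡-dec ℕ._≟_

_⊨_ : List ℕ → ℕ → Set
l ⊨ N = All (0 <_) l × size l ≡ N

compsF-fuel : ∀ {f f′} N → N ≤ f → N ≤ f′ → compsF f N ≡ compsF f′ N
compsF-fuel zero _ _ = ≡.refl
compsF-fuel {suc f} {suc f′} (suc n) (s≤s n≤f) (s≤s n≤f′) =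
  cong List.concat (ListP.map-cong (λ k → cong (map (suc k ∷_)) (compsF-fuel (n ∸ k)
    (ℕP.≤-trans (ℕP.m∸n≤m n k) n≤f) (ℕP.≤-trans (ℕP.m∸n≤m n k) n≤f′))) (upTo (suc n)))

∷-⊨ : ∀ {k n l} → k ≤ n → l ⊨ n ∸ k → suc k ∷ l ⊨ suc n
∷-⊨ {k} k≤n (pos , size≡) =
  s≤s z≤n ∷ pos , cong suc (≡.trans (cong (k ℕ.+_) size≡) (ℕP.m+[n∸m]≡n k≤n))

compsF-⊨ : ∀ f N → All (_⊨ N) (compsF f N)
compsF-⊨ f       zero    = ([] , ≡.refl) ∷ []
compsF-⊨ zero    (suc n) = []
compsF-⊨ (suc f) (suc n) = AllP.concat⁺ (AllP.map⁺ (AllP.applyUpTo⁺₁ id (suc n)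
  (λ {k} k<1+n → AllP.map⁺ (All.map (∷-⊨ (ℕP.≤-pred k<1+n)) (compsF-⊨ f (n ∸ k))))))

compositions-⊨ : ∀ N → All (_⊨ N) (compositions N)
compositions-⊨ N = compsF-⊨ N N

⊨-resp-↭ : ∀ {l l′ N} → l ↭ l′ → l ⊨ N → l′ ⊨ N
⊨-resp-↭ l↭l′ (pos , ≡.refl) = ↭P.All-resp-↭ l↭l′ pos , ≡.sym (sum-↭ l↭l′)

insertDesc-↭ : ∀ a xs → insertDesc a xs ↭ a ∷ xs
insertDesc-↭ a []       = ↭-refl
insertDesc-↭ a (b ∷ xs) with b ℕ.≤ᵇ a
... | true  = ↭-refl
... | false = ↭-trans (↭-prep b (insertDesc-↭ a xs)) (↭-swap b a ↭-refl)

sortDesc-↭ : ∀ l → sortDesc l ↭ l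
sortDesc-↭ []      = ↭-refl
sortDesc-↭ (a ∷ l) = ↭-trans (insertDesc-↭ a (sortDesc l)) (↭-prep a (sortDesc-↭ l))

Nonincreasing : List ℕ → Set
Nonincreasing l = T (nonincreasing l)

nonincreasing-∷ : ∀ {a b} xs → b ≤ a → Nonincreasing (b ∷ xs) → Nonincreasing (a ∷ b ∷ xs)
nonincreasing-∷ xs b≤a h = Equivalence.from T-∧ (ℕP.≤⇒≤ᵇ b≤a , h)

nonincreasing-head : ∀ {a b} xs → Nonincreasing (a ∷ b ∷ xs) → b ≤ a
nonincreasing-head {a} {b} xs h = ℕP.≤ᵇ⇒≤ b a (proj₁ (Equivalence.to T-∧ h))

nonincreasing-tail : ∀ a xs → Nonincreasing (a ∷ xs) → Nonincreasing xs
nonincreasing-tail a []      _ = _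
nonincreasing-tail a (_ ∷ _) h = proj₂ (Equivalence.to T-∧ h)

insertDesc-below : ∀ {a b} xs → a ≤ b → Nonincreasing (b ∷ xs) → Nonincreasing (b ∷ insertDesc a xs)
insertDesc-below [] a≤b _ = nonincreasing-∷ [] a≤b _
insertDesc-below {a} {b} (c ∷ ys) a≤b h with c ℕ.≤ᵇ a | ℕP.≤ᵇ-reflects-≤ c a
... | true  | ofʸ c≤a =
  nonincreasing-∷ (c ∷ ys) a≤b (nonincreasing-∷ ys c≤a (nonincreasing-tail b (c ∷ ys) h))
... | false | ofⁿ c≰a =
  nonincreasing-∷ (insertDesc a ys) (nonincreasing-head ys h)
    (insertDesc-below ys (ℕP.<⇒≤ (ℕP.≰⇒> c≰a)) (nonincreasing-tail b (c ∷ ys) h))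

insertDesc-nonincreasing : ∀ a xs → Nonincreasing xs → Nonincreasing (insertDesc a xs)
insertDesc-nonincreasing a []       _ = _
insertDesc-nonincreasing a (b ∷ xs) h with b ℕ.≤ᵇ a | ℕP.≤ᵇ-reflects-≤ b a
... | true  | ofʸ b≤a = nonincreasing-∷ xs b≤a h
... | false | ofⁿ b≰a = insertDesc-below xs (ℕP.<⇒≤ (ℕP.≰⇒> b≰a)) h

sortDesc-nonincreasing : ∀ l → Nonincreasing (sortDesc l)
sortDesc-nonincreasing []      = _
sortDesc-nonincreasing (a ∷ l) = insertDesc-nonincreasing a (sortDesc l) (sortDesc-nonincreasing l)

insertDesc-head : ∀ a xs → Nonincreasing (a ∷ xs) → insertDesc a xs ≡ a ∷ xs
insertDesc-head a []       _ = ≡.refl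
insertDesc-head a (b ∷ xs) h with b ℕ.≤ᵇ a | h
... | true | _ = ≡.refl

sortDesc-nonincreasing-id : ∀ μ → Nonincreasing μ → sortDesc μ ≡ μ
sortDesc-nonincreasing-id []      _ = ≡.refl
sortDesc-nonincreasing-id (a ∷ μ) h
  rewrite sortDesc-nonincreasing-id μ (nonincreasing-tail a μ h) = insertDesc-head a μ h

module CompositionSums {c ℓ : Level} (S : CommutativeSemiring c ℓ) where
  open CommutativeSemiring S
  open ListSum S
  open import Relation.Binary.Reasoning.Setoid setoid

  ∑-compositions-∷ : ∀ N (F : List ℕ → Carrier) → F [] ≈ 0# →
    ∑ (compositions N) F ≈ ∑[ k < N ] ∑[ l ∈ compositions (N ∸ suc k) ] F (suc k ∷ l)
  ∑-compositions-∷ zero    F F[]≈0 = trans (+-identityʳ _) F[]≈0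
  ∑-compositions-∷ (suc n) F _     = begin
    ∑ (concatMap (λ k → map (suc k ∷_) (compsF n (n ∸ k))) (upTo (suc n))) F
      ≈⟨ ∑-concatMap (λ k → map (suc k ∷_) (compsF n (n ∸ k))) (upTo (suc n)) F ⟩
    ∑[ k ∈ upTo (suc n) ] ∑ (map (suc k ∷_) (compsF n (n ∸ k))) F
      ≈⟨ ∑-cong (upTo (suc n)) (λ k → reflexive (≡.trans (∑-map (suc k ∷_) (compsF n (n ∸ k)) F)
           (cong (λ ls → ∑ ls (F ∘ (suc k ∷_)))
                 (compsF-fuel (n ∸ k) (ℕP.m∸n≤m n k) ℕP.≤-refl)))) ⟩
    ∑[ k ∈ upTo (suc n) ] ∑[ l ∈ compositions (n ∸ k) ] F (suc k ∷ l)
      ≡⟨ ∑-upTo (suc n) _ ⟩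
    ∑[ k < suc n ] ∑[ l ∈ compositions (n ∸ k) ] F (suc k ∷ l) ∎

  ∑-compositions-δ : ∀ {l N} → l ⊨ N → (G : List ℕ → Carrier) →
    ∑[ μ ∈ compositions N ] (if does (l ≟ₗ μ) then G μ else 0#) ≈ G l
  ∑-compositions-δ {l} (pos , ≡.refl) = go l pos
    where
    ∑-if-∧ : ∀ t (p : List ℕ → Bool) (f : List ℕ → Carrier) ls →
      ∑[ μ ∈ ls ] (if t ∧ p μ then f μ else 0#)
        ≈ (if t then ∑[ μ ∈ ls ] (if p μ then f μ else 0#) else 0#)
    ∑-if-∧ true  p f ls = refl
    ∑-if-∧ false p f ls = ∑-zero ls

    go : ∀ l → All (0 <_) l → (G : List ℕ → Carrier) →
      ∑[ μ ∈ compositions (size l) ] (if does (l ≟ₗ μ) then G μ else 0#) ≈ G l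
    go []           []              G = +-identityʳ _
    go (suc b ∷ xs) (s≤s z≤n ∷ pos) G = begin
      ∑[ μ ∈ compositions (suc n) ] (if does (suc b ∷ xs ≟ₗ μ) then G μ else 0#)
        ≈⟨ ∑-compositions-∷ (suc n) _ refl ⟩
      ∑< (suc n) Fₖ
        ≈⟨ ∑<-cong (suc n) {f = Fₖ} {f′ = λ k → if does (b ℕ.≟ k) then Gₖ k else 0#} (λ k _ →
             ∑-if-∧ (does (b ℕ.≟ k)) (λ μ → does (xs ≟ₗ μ)) (G ∘ (suc k ∷_)) (compositions (n ∸ k))) ⟩
      ∑[ k < suc n ] (if does (b ℕ.≟ k) then Gₖ k else 0#)
        ≈⟨ ∑<-δ Gₖ (s≤s (ℕP.m≤m+n b (size xs))) ⟩
      Gₖ b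
        ≡⟨ cong (λ N → ∑[ μ ∈ compositions N ] (if does (xs ≟ₗ μ) then G (suc b ∷ μ) else 0#))
                (ℕP.m+n∸m≡n b (size xs)) ⟩
      ∑[ μ ∈ compositions (size xs) ] (if does (xs ≟ₗ μ) then G (suc b ∷ μ) else 0#)
        ≈⟨ go xs pos (G ∘ (suc b ∷_)) ⟩
      G (suc b ∷ xs) ∎
      where
      n = b ℕ.+ size xs
      Fₖ Gₖ : ℕ → Carrier
      Fₖ k = ∑[ μ ∈ compositions (n ∸ k) ]
               (if does (b ℕ.≟ k) ∧ does (xs ≟ₗ μ) then G (suc k ∷ μ) else 0#)
      Gₖ k = ∑[ μ ∈ compositions (n ∸ k) ] (if does (xs ≟ₗ μ) then G (suc k ∷ μ) else 0#)

  ∑-compositions-involution : ∀ N (σ : List ℕ → List ℕ) → (∀ l → σ (σ l) ≡ l) →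
    (∀ {l} → l ⊨ N → σ l ⊨ N) → (F : List ℕ → Carrier) →
    ∑[ l ∈ compositions N ] F (σ l) ≈ ∑ (compositions N) F
  ∑-compositions-involution N σ σσ≡id σ-⊨ F = begin
    ∑[ l ∈ Cs ] F (σ l)
      ≈⟨ ∑-cong-All (All.map (λ l⊨N → sym (∑-compositions-δ (σ-⊨ l⊨N) F)) (compositions-⊨ N)) ⟩
    ∑[ l ∈ Cs ] ∑[ μ ∈ Cs ] (if does (σ l ≟ₗ μ) then F μ else 0#)
      ≈⟨ ∑-comm Cs Cs _ ⟩
    ∑[ μ ∈ Cs ] ∑[ l ∈ Cs ] (if does (σ l ≟ₗ μ) then F μ else 0#)
      ≈⟨ ∑-cong Cs (λ μ → ∑-cong Cs (λ l →
           reflexive (cong (λ t → if t then F μ else 0#) (σ-adjoint l μ)))) ⟩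
    ∑[ μ ∈ Cs ] ∑[ l ∈ Cs ] (if does (σ μ ≟ₗ l) then F μ else 0#)
      ≈⟨ ∑-cong-All (All.map (λ {μ} μ⊨N → ∑-compositions-δ (σ-⊨ μ⊨N) (λ _ → F μ))
                             (compositions-⊨ N)) ⟩
    ∑[ μ ∈ Cs ] F μ ∎
    where
    Cs = compositions N
    σ-adjoint : ∀ l μ → does (σ l ≟ₗ μ) ≡ does (σ μ ≟ₗ l)
    σ-adjoint l μ with σ l ≟ₗ μ | σ μ ≟ₗ l
    ... | yes _     | yes _     = ≡.refl
    ... | no  _     | no  _     = ≡.refl
    ... | yes σl≡μ  | no  σμ≢l  = contradiction (≡.trans (cong σ (≡.sym σl≡μ)) (σσ≡id l)) σμ≢l
    ... | no  σl≢μ  | yes σμ≡l  = contradiction (≡.trans (cong σ (≡.sym σμ≡l)) (σσ≡id μ)) σl≢μ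

module Expansion {c ℓ : Level} (R : CommutativeRing c ℓ) (g h : ℕ → CommutativeRing.Carrier R) where
  open CommutativeRing R
  open Gen R
  open Arith g h
  open ListSum commutativeSemiring
  open CompositionSums commutativeSemiring
  open import Relation.Binary.Reasoning.Setoid setoid
  open import Algebra.Properties.CommutativeSemigroup *-commutativeSemigroup using (x∙yz≈y∙xz; xy∙z≈y∙xz)

  hm-suc : ∀ j n → hm (suc j) (suc n) ≡ h (suc n) * hm j n
  hm-suc j n = cong (h (suc n) *_) (cong Πl (≡.trans (ListP.map-applyUpTo suc (λ k → hext (suc n ∸ k)) j)
                                                      (≡.sym (ListP.map-upTo (λ k → hext (n ∸ k)) j))))

  hm-vanishes : ∀ {j n} → n < j → hm j n ≈ 0#
  hm-vanishes {suc j} {zero}  _         = zeroˡ _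
  hm-vanishes {suc j} {suc n} (s≤s n<j) =
    trans (reflexive (hm-suc j n)) (trans (*-congˡ (hm-vanishes n<j)) (zeroʳ _))

  Hrev-vanishes : ∀ r {n} → n < size r ℕ.+ length r → Hrev r n ≈ 0#
  Hrev-vanishes (a ∷ r) {n} n<B = go (n ℕ.<ᵇ size (a ∷ r) ℕ.+ length (a ∷ r)) (ℕP.<ᵇ-reflects-< n _)
    where
    go : ∀ {X} b → Reflects (n < size (a ∷ r) ℕ.+ length (a ∷ r)) b → (if b then 0# else X) ≈ 0#
    go true  _          = refl
    go false (ofⁿ n≮B)  = contradiction n<B n≮B

  ΔHrev : List ℕ → ℕ → Carrier
  ΔHrev []      n = 0#
  ΔHrev (a ∷ r) n = hm a n * Hrev r (n ∸ a)

  size+length-∷ : ∀ a r → size (a ∷ r) ℕ.+ length (a ∷ r) ≡ suc (a ℕ.+ (size r ℕ.+ length r))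
  size+length-∷ a r =
    ≡.trans (ℕP.+-suc (a ℕ.+ size r) (length r)) (cong suc (ℕP.+-assoc a (size r) (length r)))

  -- The sum defining H(μ,n) may as well start at k = 0: the earlier terms vanish.
  Hrev-∷ : ∀ a r n → Hrev (a ∷ r) n ≈ ∑[ k < n ] ΔHrev (a ∷ r) k
  Hrev-∷ a r n = go n (n ℕ.<ᵇ B) (ℕP.<ᵇ-reflects-< n B)
    where
    B = size (a ∷ r) ℕ.+ length (a ∷ r)
    t = a ℕ.+ (size r ℕ.+ length r)
    F = ΔHrev (a ∷ r)

    F-vanishes : ∀ k → k < t → F k ≈ 0#
    F-vanishes k k<t with k ℕ.<? a
    ... | yes k<a = trans (*-congʳ (hm-vanishes k<a)) (zeroˡ _)
    ... | no  k≮a = trans (*-congˡ (Hrev-vanishes r (≡.subst (k ∸ a <_) (ℕP.m+n∸m≡n a _)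
                            (ℕP.∸-monoˡ-< k<t (ℕP.≮⇒≥ k≮a))))) (zeroʳ _)

    go : ∀ n b → Reflects (n < B) b → (if b then 0# else sumRange (B ∸ 1) (n ∸ 1) F) ≈ ∑< n F
    go n true (ofʸ n<B) = sym (∑<-vanishes n (λ k k<n → F-vanishes k
      (ℕP.<-≤-trans k<n (ℕP.≤-pred (≡.subst (n <_) (size+length-∷ a r) n<B)))))
    go zero    false (ofⁿ 0≮B) =
      contradiction (≡.subst (0 <_) (≡.sym (size+length-∷ a r)) (s≤s z≤n)) 0≮B
    go (suc m) false (ofⁿ n≮B) = begin
      sumRange (B ∸ 1) m F                     ≡⟨ ∑-upTo (suc m ∸ (B ∸ 1)) (λ i → F (B ∸ 1 ℕ.+ i)) ⟩
      ∑[ i < suc m ∸ (B ∸ 1) ] F (B ∸ 1 ℕ.+ i) ≡⟨ cong (λ s → ∑[ i < suc m ∸ s ] F (s ℕ.+ i))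
                                                         (cong (_∸ 1) (size+length-∷ a r)) ⟩
      ∑[ i < suc m ∸ t ] F (t ℕ.+ i)           ≈⟨ ∑<-drop F t≤1+m F-vanishes ⟨
      ∑< (suc m) F                             ∎
      where
      t≤1+m : t ≤ suc m
      t≤1+m = ℕP.<⇒≤ (≡.subst (_≤ suc m) (size+length-∷ a r) (ℕP.≮⇒≥ n≮B))

  Hrev-suc : ∀ r n → Hrev r (suc n) ≈ Hrev r n + ΔHrev r n
  Hrev-suc []      n = sym (+-identityʳ _)
  Hrev-suc (a ∷ r) n = begin
    Hrev (a ∷ r) (suc n)                   ≈⟨ Hrev-∷ a r (suc n) ⟩
    ∑< (suc n) (ΔHrev (a ∷ r))             ≈⟨ ∑<-suc n (ΔHrev (a ∷ r)) ⟩
    ∑< n (ΔHrev (a ∷ r)) + ΔHrev (a ∷ r) n ≈⟨ +-congʳ (Hrev-∷ a r n) ⟨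
    Hrev (a ∷ r) n + ΔHrev (a ∷ r) n       ∎

  Hrev-vanishes-⊨ : ∀ {r n} → r ⊨ suc n → Hrev r (suc n) ≈ 0#
  Hrev-vanishes-⊨ {a ∷ r} (_ , size≡) =
    Hrev-vanishes (a ∷ r) (≡.subst (_< size (a ∷ r) ℕ.+ length (a ∷ r)) size≡ (ℕP.m<m+n _ (s≤s z≤n)))

  *-distribˡ-∑-ΔHrev : ∀ k n N →
    g (suc (suc k)) * (hm (suc k) n * (∑[ r ∈ compositions N ] 𝒢 r * Hrev r (n ∸ suc k)))
      ≈ ∑[ r ∈ compositions N ] 𝒢 (suc k ∷ r) * ΔHrev (suc k ∷ r) n
  *-distribˡ-∑-ΔHrev k n N = begin
    gₖ * (hₖ * (∑[ r ∈ Cs ] 𝒢 r * Hrev r n′))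
      ≈⟨ *-congˡ (*-distribˡ-∑ hₖ Cs (λ r → 𝒢 r * Hrev r n′)) ⟩
    gₖ * (∑[ r ∈ Cs ] hₖ * (𝒢 r * Hrev r n′))
      ≈⟨ *-distribˡ-∑ gₖ Cs (λ r → hₖ * (𝒢 r * Hrev r n′)) ⟩
    ∑[ r ∈ Cs ] gₖ * (hₖ * (𝒢 r * Hrev r n′))
      ≈⟨ ∑-cong Cs (λ r → trans (*-congˡ (x∙yz≈y∙xz _ _ _)) (sym (*-assoc _ _ _))) ⟩
    ∑[ r ∈ Cs ] (gₖ * 𝒢 r) * (hₖ * Hrev r n′) ∎
    where
    gₖ = g (suc (suc k))
    hₖ = hm (suc k) n
    n′ = n ∸ suc k
    Cs = compositions N

  𝒢-resp-↭ : ∀ {l l′} → l ↭ l′ → 𝒢 l ≈ 𝒢 l′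
  𝒢-resp-↭ l↭l′ =
    foldr-commMonoid setoid *-isCommutativeMonoid (↭⇒↭ₛ′ isEquivalence (↭P.map⁺ (g ∘ suc) l↭l′))

  ∑-partitions : ∀ N n →
    ∑[ μ ∈ partitions N ] 𝒢 μ * ℋ μ n ≈ ∑[ l ∈ compositions N ] 𝒢 l * Hμ l n
  ∑-partitions N n = begin
    ∑[ μ ∈ partitions N ] 𝒢 μ * ℋ μ n
      ≈⟨ ∑-filter nonincreasing Cs (λ μ → 𝒢 μ * ℋ μ n) ⟩
    ∑[ μ ∈ Cs ] (if nonincreasing μ then 𝒢 μ * ℋ μ n else 0#)
      ≈⟨ ∑-cong-All (All.map expand-orbit (compositions-⊨ N)) ⟩
    ∑[ μ ∈ Cs ] ∑[ l ∈ Cs ] K μ l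
      ≈⟨ ∑-comm Cs Cs K ⟩
    ∑[ l ∈ Cs ] ∑[ μ ∈ Cs ] K μ l
      ≈⟨ ∑-cong-All (All.map collapse (compositions-⊨ N)) ⟩
    ∑[ l ∈ Cs ] 𝒢 l * Hμ l n ∎
    where
    Cs = compositions N

    K : List ℕ → List ℕ → Carrier
    K μ l = if nonincreasing μ then (if does (sortDesc l ≟ₗ μ) then 𝒢 μ * Hμ l n else 0#) else 0#

    expand-orbit : ∀ {μ} → μ ⊨ N →
      (if nonincreasing μ then 𝒢 μ * ℋ μ n else 0#) ≈ ∑[ l ∈ Cs ] K μ l
    expand-orbit {μ} (_ , ≡.refl) with nonincreasing μ | sortDesc-nonincreasing-id μ
    ... | false | _       = sym (∑-zero Cs)
    ... | true  | sortμ≡μ = begin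
      𝒢 μ * (∑[ l ∈ Orb μ ] Hμ l n)
        ≈⟨ *-distribˡ-∑ (𝒢 μ) (Orb μ) (λ l → Hμ l n) ⟩
      ∑[ l ∈ Orb μ ] 𝒢 μ * Hμ l n
        ≈⟨ ∑-filter (λ l → isPermOf l μ) Cs (λ l → 𝒢 μ * Hμ l n) ⟩
      ∑[ l ∈ Cs ] (if does (sortDesc l ≟ₗ sortDesc μ) then 𝒢 μ * Hμ l n else 0#)
        ≡⟨ cong (λ ν → ∑[ l ∈ Cs ] (if does (sortDesc l ≟ₗ ν) then 𝒢 μ * Hμ l n else 0#))
                (sortμ≡μ _) ⟩
      ∑[ l ∈ Cs ] (if does (sortDesc l ≟ₗ μ) then 𝒢 μ * Hμ l n else 0#) ∎

    collapse : ∀ {l} → l ⊨ N → ∑[ μ ∈ Cs ] K μ l ≈ 𝒢 l * Hμ l n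
    collapse {l} l⊨N = begin
      ∑[ μ ∈ Cs ] K μ l
        ≈⟨ ∑-cong Cs (λ μ → reflexive (if-swap-then (nonincreasing μ) (does (sortDesc l ≟ₗ μ)))) ⟩
      ∑[ μ ∈ Cs ] (if does (sortDesc l ≟ₗ μ) then (if nonincreasing μ then 𝒢 μ * Hμ l n else 0#) else 0#)
        ≈⟨ ∑-compositions-δ (⊨-resp-↭ (↭-sym (sortDesc-↭ l)) l⊨N)
                             (λ μ → if nonincreasing μ then 𝒢 μ * Hμ l n else 0#) ⟩
      (if nonincreasing (sortDesc l) then 𝒢 (sortDesc l) * Hμ l n else 0#)
        ≡⟨ if-T (sortDesc-nonincreasing l) ⟩
      𝒢 (sortDesc l) * Hμ l n
        ≈⟨ *-congʳ (𝒢-resp-↭ (sortDesc-↭ l)) ⟩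
      𝒢 l * Hμ l n ∎

  ∑-compositions-reverse : ∀ N n →
    ∑[ l ∈ compositions N ] 𝒢 l * Hμ l n ≈ ∑[ r ∈ compositions N ] 𝒢 r * Hrev r n
  ∑-compositions-reverse N n = begin
    ∑[ l ∈ compositions N ] 𝒢 l * Hrev (reverse l) n
      ≈⟨ ∑-cong (compositions N) (λ l → *-congʳ (𝒢-resp-↭ (↭-sym (↭P.↭-reverse l)))) ⟩
    ∑[ l ∈ compositions N ] 𝒢 (reverse l) * Hrev (reverse l) n
      ≈⟨ ∑-compositions-involution N reverse ListP.reverse-involutive (⊨-resp-↭ (↭-sym (↭P.↭-reverse _)))
           (λ r → 𝒢 r * Hrev r n) ⟩
    ∑[ r ∈ compositions N ] 𝒢 r * Hrev r n ∎

  module Coefficients (hinv : ℕ → Carrier) where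
    open Poly hinv

    Hprod-wsum : ∀ m n k →
      Hprod n * wsum k (Vec.toList (Ps n)) m ≈ ∑[ j < suc n ] g (k ℕ.+ j) * (hm j n * A (n ∸ j) m)
    Hprod-wsum m zero    k = begin
      1# * (g k * P 0 m + 0#)                 ≈⟨ *-identityˡ _ ⟩
      g k * P 0 m + 0#
        ≈⟨ +-congʳ (*-cong (reflexive (cong g (≡.sym (ℕP.+-identityʳ k))))
                           (sym (trans (*-identityˡ _) (*-identityˡ _)))) ⟩
      g (k ℕ.+ 0) * (1# * (1# * P 0 m)) + 0# ∎
    Hprod-wsum m (suc n) k = begin
      Hprod (suc n) * (g k * P (suc n) m + wsum (suc k) (Vec.toList (Ps n)) m)
        ≈⟨ distribˡ _ _ _ ⟩
      Hprod (suc n) * (g k * P (suc n) m) + (Hprod n * h (suc n)) * wsum (suc k) (Vec.toList (Ps n)) m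
        ≈⟨ +-cong (x∙yz≈y∙xz _ _ _) (xy∙z≈y∙xz _ _ _) ⟩
      g k * A (suc n) m + h (suc n) * (Hprod n * wsum (suc k) (Vec.toList (Ps n)) m)
        ≈⟨ +-cong (*-cong (reflexive (cong g (≡.sym (ℕP.+-identityʳ k)))) (sym (*-identityˡ _)))
                  (*-congˡ (Hprod-wsum m n (suc k))) ⟩
      g (k ℕ.+ 0) * (1# * A (suc n) m) + h (suc n) * ∑< (suc n) F
        ≈⟨ +-congˡ (*-distribˡ-∑< (h (suc n)) (suc n) F) ⟩
      g (k ℕ.+ 0) * (1# * A (suc n) m) + ∑[ j < suc n ] h (suc n) * F j
        ≈⟨ +-congˡ (∑<-cong (suc n) {f = λ j → h (suc n) * F j} {f′ = F′} (λ j _ → shift j)) ⟩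
      g (k ℕ.+ 0) * (1# * A (suc n) m) + ∑< (suc n) F′ ∎
      where
      F F′ : ℕ → Carrier
      F  j = g (suc k ℕ.+ j) * (hm j n * A (n ∸ j) m)
      F′ j = g (k ℕ.+ suc j) * (hm (suc j) (suc n) * A (n ∸ j) m)
      shift : ∀ j → h (suc n) * F j ≈ F′ j
      shift j = begin
        h (suc n) * (g (suc k ℕ.+ j) * (hm j n * A (n ∸ j) m))
          ≈⟨ x∙yz≈y∙xz _ _ _ ⟩
        g (suc k ℕ.+ j) * (h (suc n) * (hm j n * A (n ∸ j) m))
          ≈⟨ *-cong (reflexive (cong g (≡.sym (ℕP.+-suc k j)))) (sym (*-assoc _ _ _)) ⟩
        g (k ℕ.+ suc j) * ((h (suc n) * hm j n) * A (n ∸ j) m)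
          ≈⟨ *-congˡ (*-congʳ (reflexive (≡.sym (hm-suc j n)))) ⟩
        g (k ℕ.+ suc j) * (hm (suc j) (suc n) * A (n ∸ j) m) ∎

    module _ (hinv-inverse : ∀ n → 1 ≤ n → h n * hinv n ≈ 1#) where

      A-recurrence : ∀ m n → A (suc n) (suc m) ≈ ∑[ j < suc n ] g (suc j) * (hm j n * A (n ∸ j) m)
      A-recurrence m n = begin
        (Hprod n * h (suc n)) * (hinv (suc n) * W)  ≈⟨ *-assoc _ _ _ ⟩
        Hprod n * (h (suc n) * (hinv (suc n) * W))  ≈⟨ *-congˡ (*-assoc _ _ _) ⟨
        Hprod n * ((h (suc n) * hinv (suc n)) * W)  ≈⟨ *-congˡ (*-congʳ (hinv-inverse (suc n) (s≤s z≤n))) ⟩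
        Hprod n * (1# * W)                          ≈⟨ *-congˡ (*-identityˡ W) ⟩
        Hprod n * W                                 ≈⟨ Hprod-wsum m n 1 ⟩
        ∑[ j < suc n ] g (suc j) * (hm j n * A (n ∸ j) m) ∎
        where W = wsum 1 (Vec.toList (Ps n)) m

      A-vanishes : ∀ {m n} → n < m → A n m ≈ 0#
      A-vanishes {suc m} {zero}  _         = *-identityˡ 0#
      A-vanishes {suc m} {suc n} (s≤s n<m) = trans (A-recurrence m n) (∑<-vanishes (suc n)
        {λ j → g (suc j) * (hm j n * A (n ∸ j) m)} (λ j _ →
        trans (*-congˡ (trans (*-congˡ (A-vanishes (ℕP.≤-<-trans (ℕP.m∸n≤m n j) n<m))) (zeroʳ _)))
              (zeroʳ _)))

      module _ (g1≈1 : g 1 ≈ 1#) where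

        A-expansion : ∀ m n → m ≤ n → A n m ≈ ∑[ r ∈ compositions (n ∸ m) ] 𝒢 r * Hrev r n
        A-expansion zero zero _ = sym (+-identityʳ _)
        A-expansion zero (suc n) _ = trans (zeroʳ _) (sym (trans
          (∑-cong-All (All.map (λ r⊨1+n → trans (*-congˡ (Hrev-vanishes-⊨ r⊨1+n)) (zeroʳ _))
                               (compositions-⊨ (suc n))))
          (∑-zero (compositions (suc n)))))
        A-expansion (suc m) (suc n) (s≤s m≤n) = begin
          A (suc n) (suc m)
            ≈⟨ A-recurrence m n ⟩
          g 1 * (hm 0 n * A n m) + ∑< n Tⱼ
            ≈⟨ +-cong leading rest ⟩
          ∑[ r ∈ Cs ] 𝒢 r * Hrev r n + ∑[ r ∈ Cs ] 𝒢 r * ΔHrev r n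
            ≈⟨ ∑-distrib-+ Cs (λ r → 𝒢 r * Hrev r n) (λ r → 𝒢 r * ΔHrev r n) ⟨
          ∑[ r ∈ Cs ] (𝒢 r * Hrev r n + 𝒢 r * ΔHrev r n)
            ≈⟨ ∑-cong Cs (λ r → trans (*-congˡ (Hrev-suc r n)) (distribˡ _ _ _)) ⟨
          ∑[ r ∈ Cs ] 𝒢 r * Hrev r (suc n) ∎
          where
          Cs = compositions (n ∸ m)
          Tⱼ : ℕ → Carrier
          Tⱼ j = g (suc (suc j)) * (hm (suc j) n * A (n ∸ suc j) m)

          leading : g 1 * (hm 0 n * A n m) ≈ ∑[ r ∈ Cs ] 𝒢 r * Hrev r n
          leading = trans (*-cong g1≈1 (*-identityˡ _)) (trans (*-identityˡ _) (A-expansion m n m≤n))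

          m≤n∸1+k : ∀ {k} → k < n ∸ m → m ≤ n ∸ suc k
          m≤n∸1+k {k} k<n∸m =
            ℕP.m+n≤o⇒m≤o∸n m
              (≡.subst (m ℕ.+ suc k ≤_) (ℕP.m+[n∸m]≡n m≤n) (ℕP.+-monoʳ-≤ m k<n∸m))

          induction-hypothesis : ∀ {k} → k < n ∸ m →
            A (n ∸ suc k) m ≈ ∑[ r ∈ compositions (n ∸ m ∸ suc k) ] 𝒢 r * Hrev r (n ∸ suc k)
          induction-hypothesis {k} k<n∸m = trans (A-expansion m (n ∸ suc k) (m≤n∸1+k k<n∸m))
            (reflexive (cong (λ N → ∑[ r ∈ compositions N ] 𝒢 r * Hrev r (n ∸ suc k))
                             (∸-comm n (suc k) m)))

          rest : ∑< n Tⱼ ≈ ∑[ r ∈ Cs ] 𝒢 r * ΔHrev r n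
          rest = begin
            ∑< n Tⱼ
              ≈⟨ ∑<-truncate Tⱼ (ℕP.m∸n≤m n m) (λ j n∸m≤j j<n →
                   trans (*-congˡ (trans (*-congˡ (A-vanishes (∸-suc-< n∸m≤j j<n))) (zeroʳ _))) (zeroʳ _)) ⟩
            ∑< (n ∸ m) Tⱼ
              ≈⟨ ∑<-cong (n ∸ m) (λ k k<n∸m → *-congˡ (*-congˡ (induction-hypothesis k<n∸m))) ⟩
            ∑[ k < n ∸ m ] g (suc (suc k)) *
              (hm (suc k) n * (∑[ r ∈ compositions (n ∸ m ∸ suc k) ] 𝒢 r * Hrev r (n ∸ suc k)))
              ≈⟨ ∑<-cong (n ∸ m) (λ k _ → *-distribˡ-∑-ΔHrev k n (n ∸ m ∸ suc k)) ⟩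
            ∑[ k < n ∸ m ] ∑[ r ∈ compositions (n ∸ m ∸ suc k) ] 𝒢 (suc k ∷ r) * ΔHrev (suc k ∷ r) n
              ≈⟨ ∑-compositions-∷ (n ∸ m) (λ r → 𝒢 r * ΔHrev r n) (zeroʳ _) ⟨
            ∑[ r ∈ Cs ] 𝒢 r * ΔHrev r n ∎

mainTheorem1 : ∀ {c ℓ : Level} (R : CommutativeRing c ℓ) →
    let open CommutativeRing R in
    (g h hinv : ℕ → Carrier) →
    g 1 ≈ 1# → h 1 ≈ 1# →
    (∀ n → 1 ≤ n → h n * hinv n ≈ 1#) →
    (m n : ℕ) → 1 ≤ m → m < n →
    Gen.Arith.Poly.A R g h hinv n m
      ≈ Gen.Σl R (map (λ mu → Gen.Arith.𝒢 R g h mu * Gen.Arith.ℋ R g h mu n) (partitions (n ∸ m)))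
mainTheorem1 R g h hinv g1≈1 _ hinv-inverse m n _ m<n = begin
  A n m                                                ≈⟨ A-expansion hinv-inverse g1≈1 m n (ℕP.<⇒≤ m<n) ⟩
  ∑[ r ∈ compositions (n ∸ m) ] 𝒢 r * Hrev r n         ≈⟨ ∑-compositions-reverse (n ∸ m) n ⟨
  ∑[ l ∈ compositions (n ∸ m) ] 𝒢 l * Hμ l n           ≈⟨ ∑-partitions (n ∸ m) n ⟨
  ∑[ μ ∈ partitions (n ∸ m) ] 𝒢 μ * ℋ μ n              ∎
  where
  open CommutativeRing R
  open import Relation.Binary.Reasoning.Setoid setoid
  open Gen R
  open Arith g h
  open Poly hinv
  open ListSum commutativeSemiring
  open Expansion R g h
  open Coefficients hinv
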